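{- Let $r,s\in\mathbb N$ with $r\ge 2s$, and let $a_1,\dots,a_{2s-1}\in[1,r-1]$ with $a_i<a_{i+1}$ for $i=1,\dots,2s-2$ (if $s\ge 2$). Let $x_1=a_1$, $x_i=\sum_{j=0}^{i-1}a_{2j+1}-\sum_{j=1}^{i-1}a_{2j}$ for $i=2,\dots,s$ (if $s\ge2$), and, for $s\ge 2$, $y_i=\sum_{j=0}^{i-1}a_{2j+1}-\sum_{j=1}^{i}a_{2j}+r$ for $i=1,\dots,s-1$. Let $G$ be a bipartite graph with vertex bipartition $\{A,B\}$ with $|A|=|B|=s$, and let $f\colon A\cup B\to[0,r-1]$ be a $\overline{\rho}$-labeling with $f(A)=\{x_1-1,\dots,x_s-1\}$ and $f(B)=\{y_1-1,\dots,y_{s-1}-1,r-1\}$. Then: (1) the $k$-shift $f_k$ is an $(A,B,r-1)$-uniformly ordered labeling of $G$ if and only if $k\in\{0\}\cup[r+1-a_1,r-1]$ when $a_1\ge 2$, and if and only if $k=0$ when $a_1=1$; (2) $f_k$ is $(B,A,r-1)$-uniformly ordered if and only if $k\in[r+1-y_{s-1},\,r-x_s]$.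
   Context: $\mathbb N=\{0,1,2,\dots\}$; $[a,b]=\{x\in\mathbb N: a\le x\le b\}$. Graphs have no isolated vertices. For a graph $G=(V,E)$ with $|E|=m$ and $t\in\mathbb N$, a labeling is an injective map $f\colon V\to[0,t]$; it induces $\tilde f(\{u,v\})=|f(u)-f(v)|$. $f$ is a $\overline{\rho}$-labeling if (a) $t\ge 2m$, (b) $\tilde f$ is injective, (c) there is no $i\in\{1,\dots,m\}$ with both $i$ and $t+1-i$ in $\operatorname{Im}\tilde f$. For bipartite $G$ with vertex bipartition $\{A,B\}$, an $(A,B,t)$-uniformly ordered labeling is a $\overline{\rho}$-labeling $f\colon V\to[0,t]$ such that there is $\lambda\in\mathbb N$ with $f(a)\le\lambda$ for all $a\in A$ and $f(b)>\lambda$ for all $b\in B$; $(B,A,t)$-uniformly ordered is defined with $A,B$ exchanged. For $k\in[0,t]$, the $k$-shift of $f$ is $f_k(v)=f(v)+k$ reduced modulo $t+1$ into $[0,t]$. -}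

module Defs where

open import Data.Nat using (ℕ; zero; suc; _+_; _*_; _∸_; _≤_; _<_; ∣_-_∣)
open import Data.Nat.DivMod using (_%_)
open import Data.Integer using (ℤ) renaming (_+_ to _+ℤ_; _-_ to _-ℤ_; +_ to ℤ+)
open import Data.Fin using (Fin)
open import Data.Sum using (_⊎_; inj₁; inj₂)
open import Data.Product using (_×_; _,_; ∃; ∃-syntax)
open import Data.List using (List; length)
open import Data.List.Membership.Propositional using (_∈_)
open import Data.List.Relation.Unary.Unique.Propositional using (Unique)
open import Relation.Binary.PropositionalEquality using (_≡_)
open import Relation.Nullary using (¬_)

-- Vertices of a bipartite graph with parts A = inj₁ (Fin s), B = inj₂ (Fin s).
Vertex : ℕ → Set
Vertex s = Fin s ⊎ Fin s

-- An edge (a , b) joins vertex inj₁ a ∈ A with vertex inj₂ b ∈ B.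
Edge : ℕ → Set
Edge s = Fin s × Fin s

IsBipGraph : (s : ℕ) → List (Edge s) → Set
IsBipGraph s E =
  Unique E
  × (∀ (u : Fin s) → ∃[ b ] ((u , b) ∈ E))
  × (∀ (u : Fin s) → ∃[ a ] ((a , u) ∈ E))

edgeLabel : {s : ℕ} → (Vertex s → ℕ) → Edge s → ℕ
edgeLabel f (a , b) = ∣ f (inj₁ a) - f (inj₂ b) ∣

InEdgeImage : {s : ℕ} → List (Edge s) → (Vertex s → ℕ) → ℕ → Set
InEdgeImage E f d = ∃[ e ] (e ∈ E × edgeLabel f e ≡ d)

IsRhoBar : (s : ℕ) → List (Edge s) → ℕ → (Vertex s → ℕ) → Set
IsRhoBar s E t f =
  (∀ v → f v ≤ t)
  × (∀ u v → f u ≡ f v → u ≡ v)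
  × (2 * length E ≤ t)
  × (∀ e e' → e ∈ E → e' ∈ E → edgeLabel f e ≡ edgeLabel f e' → e ≡ e')
  × (∀ i → 1 ≤ i → i ≤ length E →
       ¬ (InEdgeImage E f i × InEdgeImage E f (suc t ∸ i)))

IsUOAB : (s : ℕ) → List (Edge s) → ℕ → (Vertex s → ℕ) → Set
IsUOAB s E t f = IsRhoBar s E t f
  × ∃[ λ' ] ((∀ a → f (inj₁ a) ≤ λ') × (∀ b → λ' < f (inj₂ b)))

IsUOBA : (s : ℕ) → List (Edge s) → ℕ → (Vertex s → ℕ) → Set
IsUOBA s E t f = IsRhoBar s E t f
  × ∃[ λ' ] ((∀ b → f (inj₂ b) ≤ λ') × (∀ a → λ' < f (inj₁ a)))

shift : {s : ℕ} → ℕ → (Vertex s → ℕ) → ℕ → Vertex s → ℕ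
shift t f k v = (f v + k) % suc t

sumTo : ℕ → (ℕ → ℤ) → ℤ
sumTo zero g = ℤ+ 0
sumTo (suc n) g = sumTo n g +ℤ g n

-- x_i = Σ_{j=0}^{i-1} a_{2j+1} − Σ_{j=1}^{i-1} a_{2j}   (a indexed from 1)
xs : (ℕ → ℕ) → ℕ → ℤ
xs a i = sumTo i (λ j → ℤ+ (a (suc (2 * j)))) -ℤ sumTo (i ∸ 1) (λ j → ℤ+ (a (2 * suc j)))

-- y_i = Σ_{j=0}^{i-1} a_{2j+1} − Σ_{j=1}^{i} a_{2j} + r
ys : (ℕ → ℕ) → ℕ → ℕ → ℤ
ys a r i = (sumTo i (λ j → ℤ+ (a (suc (2 * j)))) -ℤ sumTo i (λ j → ℤ+ (a (2 * suc j)))) +ℤ ℤ+ r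

ImageIs : {s : ℕ} → (Fin s → ℕ) → (ℤ → Set) → Set
ImageIs {s} g P = (∀ u → P (ℤ+ (g u))) × (∀ z → P z → ∃[ u ] (ℤ+ (g u) ≡ z))

{-# OPTIONS --safe #-}
-- Since x is increasing, y is decreasing and xₛ + r = y_{s-1} + a_{2s-1} < y_{s-1} + r, the labeling
-- f maps A into [x₁ - 1, xₛ - 1] and B into [y_{s-1} - 1, r - 1], every A-label lies below every
-- B-label, and all four endpoints are attained. The k-shift adds k modulo r, so exactly the labels
-- ≥ r - k wrap around. If no label or every label wraps (k = 0 or x₁ - 1 + k ≥ r), all vertices
-- move by the same amount, so the edge labels and the order of A below B are kept. If exactly the
-- B-labels wrap (r + 1 - y_{s-1} ≤ k ≤ r - xₛ), B lands below A and every edge label d becomes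
-- r - d, which preserves the ρ̄ conditions since they are symmetric under d ↦ r - d. In every other
-- case the order fails at an extreme vertex: the B-label r - 1 lands on k - 1, below an unwrapped
-- A-label or above a wrapped one, or the least B-label does not wrap and stays above the greatest
-- A-label.
module Submission where

open import Defs
open import Level using (Level)
open import Data.Nat
open import Data.Nat.Properties
open import Data.Nat.DivMod
  using (_%_; %-distribˡ-+; m%n%n≡m%n; [m+n]%n≡m%n; m≤n⇒m%n≡m; m≤n⇒[n∸m]%m≡n%m; m<n⇒m%n≡m; m%n<n)
open import Data.Integer as ℤ using (ℤ; +_; +≤+) renaming (_+_ to _+ℤ_; _-_ to _-ℤ_; _≤_ to _≤ℤ_)
open import Data.Integer using () renaming (+_ to ℤ+)
import Data.Integer.Properties as ℤ
open import Data.Integer.Tactic.RingSolver using (solve-∀)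
open import Data.Fin using (Fin)
open import Data.Sum using (_⊎_; inj₁; inj₂; [_,_])
open import Data.Sum.Function.Propositional using (_⊎-⇔_)
open import Data.Product using (_×_; _,_; ∃-syntax; proj₁; proj₂)
open import Data.Product.Function.NonDependent.Propositional using (_×-⇔_)
open import Data.List using (List; length)
open import Data.List.Membership.Propositional using (_∈_)
open import Function using (id; flip)
open import Function.Bundles using (_⇔_; mk⇔)
import Function.Properties.Equivalence as ⇔
open import Relation.Binary.Core using (Rel)
open import Relation.Binary.Definitions using (Reflexive; Transitive)
open import Relation.Binary.PropositionalEquality hiding ([_])
open import Relation.Nullary using (¬_; yes; no; contradiction)

private
  variable
    m n o p k t s : ℕ

+-suc-comm : ∀ m n → m + suc n ≡ n + suc m
+-suc-comm m n = trans (+-suc m n) (+-comm (suc m) n)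

∣m+o-n+o∣≡∣m-n∣ : ∀ m n o → ∣ m + o - n + o ∣ ≡ ∣ m - n ∣
∣m+o-n+o∣≡∣m-n∣ m n o = trans (cong₂ ∣_-_∣ (+-comm m o) (+-comm n o)) (∣m+n-m+o∣≡∣n-o∣ o m n)

∣-∣-offset : ∀ {m n m′ n′ c k} → m + c ≡ m′ + k → n + c ≡ n′ + k → ∣ m - n ∣ ≡ ∣ m′ - n′ ∣
∣-∣-offset {m} {n} {m′} {n′} {c} {k} e₁ e₂ = begin
  ∣ m - n ∣               ≡⟨ ∣m+o-n+o∣≡∣m-n∣ m n c ⟨
  ∣ m + c - n + c ∣       ≡⟨ cong₂ ∣_-_∣ e₁ e₂ ⟩
  ∣ m′ + k - n′ + k ∣     ≡⟨ ∣m+o-n+o∣≡∣m-n∣ m′ n′ k ⟩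
  ∣ m′ - n′ ∣             ∎
  where open ≡-Reasoning

m+n≡o+p⇒n≤p⇒∣m-o∣≡p∸n : m + n ≡ o + p → n ≤ p → ∣ m - o ∣ ≡ p ∸ n
m+n≡o+p⇒n≤p⇒∣m-o∣≡p∸n {m} {n} {o} {p} eq n≤p = begin
  ∣ m - o ∣                ≡⟨ m≤n⇒∣n-m∣≡n∸m o≤m ⟩
  m ∸ o                    ≡⟨ [m+n]∸[m+o]≡n∸o n m o ⟨
  (n + m) ∸ (n + o)        ≡⟨ cong₂ _∸_ (trans (+-comm n m) eq) (+-comm n o) ⟩
  (o + p) ∸ (o + n)        ≡⟨ [m+n]∸[m+o]≡n∸o o p n ⟩
  p ∸ n                    ∎
  where
  open ≡-Reasoning
  o≤m : o ≤ m
  o≤m = +-cancelʳ-≤ p o m (≤-trans (≤-reflexive (sym eq)) (+-monoʳ-≤ m n≤p))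

m+1∸n≤k⇔m<n+k : (m + 1 ∸ n ≤ k) ⇔ (m < n + k)
m+1∸n≤k⇔m<n+k {m} {n} {k} = mk⇔
  (λ le → subst (_≤ n + k) (+-comm m 1) (≤-trans (m≤n+m∸n (m + 1) n) (+-monoʳ-≤ n le)))
  (λ lt → m≤n+o⇒m∸n≤o (m + 1) n (subst (_≤ n + k) (+-comm 1 m) lt))

k≤m∸n⇔n+k≤m : n ≤ m → (k ≤ m ∸ n) ⇔ (n + k ≤ m)
k≤m∸n⇔n+k≤m {n} {m} {k} n≤m = mk⇔
  (λ le → subst (_≤ m) (+-comm k n) (m≤o∸n⇒m+n≤o k n≤m le))
  (λ le → m+n≤o⇒m≤o∸n k (subst (_≤ m) (+-comm n k) le))

+m≡p-1⇒p≡+[1+m] : ∀ {m p} → + m ≡ p -ℤ + 1 → p ≡ + suc m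
+m≡p-1⇒p≡+[1+m] {m} {p} eq = trans (identity p) (cong (+ 1 +ℤ_) (sym eq))
  where
  identity : ∀ p → p ≡ + 1 +ℤ (p -ℤ + 1)
  identity = solve-∀

+[1+m]≤+[1+n]⇒m≤n : ∀ {p q m n} → p ≡ + suc m → q ≡ + suc n → p ≤ℤ q → m ≤ n
+[1+m]≤+[1+n]⇒m≤n refl refl p≤q = s≤s⁻¹ (ℤ.drop‿+≤+ p≤q)

+[1+m]-+[1+n]≡+[m∸n] : ∀ m n → n ≤ m → + suc m -ℤ + suc n ≡ + (m ∸ n)
+[1+m]-+[1+n]≡+[m∸n] m n n≤m = trans (ℤ.[+m]-[+n]≡m⊖n (suc m) (suc n)) (ℤ.⊖-≥ (s≤s n≤m))

+≤+⇔≤ : ∀ {m n} → (+ m ≤ℤ + n) ⇔ (m ≤ n)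
+≤+⇔≤ = mk⇔ ℤ.drop‿+≤+ +≤+

p+c≡q+d⇒c≤d⇒q≤p : ∀ {p q c d} → p +ℤ c ≡ q +ℤ d → c ≤ℤ d → q ≤ℤ p
p+c≡q+d⇒c≤d⇒q≤p {p} {q} {c} {d} eq c≤d = begin
  q             ≡⟨ cancel q d ⟨
  (q +ℤ d) -ℤ d ≡⟨ cong (_-ℤ d) eq ⟨
  (p +ℤ c) -ℤ d ≤⟨ ℤ.+-monoˡ-≤ (ℤ.- d) (ℤ.+-monoʳ-≤ p c≤d) ⟩
  (p +ℤ d) -ℤ d ≡⟨ cancel p d ⟩
  p             ∎
  where
  open ℤ.≤-Reasoning
  cancel : ∀ x y → (x +ℤ y) -ℤ y ≡ x
  cancel = solve-∀

module _ {ℓ r : Level} {A : Set ℓ} {_≼_ : Rel A r} (≼-refl : Reflexive _≼_) (≼-trans : Transitive _≼_)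
         (g : ℕ → A) {lo hi : ℕ} (step : ∀ m → lo ≤ m → suc m ≤ hi → g m ≼ g (suc m)) where

  stepwise⇒monotone : ∀ {i j} → lo ≤ i → i ≤ j → j ≤ hi → g i ≼ g j
  stepwise⇒monotone {i} {zero}  _    z≤n  _    = ≼-refl
  stepwise⇒monotone {i} {suc j} lo≤i i≤1+j j≤hi with m≤n⇒m<n∨m≡n i≤1+j
  ... | inj₂ refl       = ≼-refl
  ... | inj₁ (s≤s i≤j) =
    ≼-trans (stepwise⇒monotone lo≤i i≤j (≤-trans (n≤1+n j) j≤hi)) (step j (≤-trans lo≤i i≤j) j≤hi)

-- Addition modulo t + 1

[m%n+o]%n≡[m+o]%n : ∀ m o n .{{_ : NonZero n}} → (m % n + o) % n ≡ (m + o) % n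
[m%n+o]%n≡[m+o]%n m o n = begin
  (m % n + o) % n          ≡⟨ %-distribˡ-+ (m % n) o n ⟩
  (m % n % n + o % n) % n  ≡⟨ cong (λ x → (x + o % n) % n) (m%n%n≡m%n m n) ⟩
  (m % n + o % n) % n      ≡⟨ %-distribˡ-+ m o n ⟨
  (m + o) % n              ∎
  where open ≡-Reasoning

n≤m<2n⇒m%n+n≡m : ∀ {m n} .{{_ : NonZero n}} → n ≤ m → m < n + n → m % n + n ≡ m
n≤m<2n⇒m%n+n≡m {m} {n} n≤m m<2n = begin
  m % n + n        ≡⟨ cong (_+ n) (m≤n⇒[n∸m]%m≡n%m n≤m) ⟨
  (m ∸ n) % n + n  ≡⟨ cong (_+ n) (m<n⇒m%n≡m (m<n+o⇒m∸n<o m n m<2n)) ⟩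
  m ∸ n + n        ≡⟨ m∸n+n≡m n≤m ⟩
  m                ∎
  where open ≡-Reasoning

[m+n]%[1+t]+[1+t]≡m+n : m ≤ t → n ≤ t → t < m + n → (m + n) % suc t + suc t ≡ m + n
[m+n]%[1+t]+[1+t]≡m+n {m} {t} {n} m≤t n≤t t<m+n =
  n≤m<2n⇒m%n+n≡m t<m+n (s≤s (≤-trans (+-mono-≤ m≤t n≤t) (+-monoʳ-≤ t (n≤1+n t))))

[t+1+k]%[1+t]≡k : k ≤ t → (t + suc k) % suc t ≡ k
[t+1+k]%[1+t]≡k {k} {t} k≤t =
  trans (cong (_% suc t) (+-suc-comm t k)) (trans ([m+n]%n≡m%n k (suc t)) (m≤n⇒m%n≡m k≤t))

[m+k]%[1+t]≡[n+k]%[1+t]⇒m≡n : m ≤ t → n ≤ t → k ≤ suc t → (m + k) % suc t ≡ (n + k) % suc t → m ≡ n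
[m+k]%[1+t]≡[n+k]%[1+t]⇒m≡n {m} {t} {n} {k} m≤t n≤t k≤1+t eq =
  trans (sym (unshift m≤t)) (trans (cong (λ x → (x + (suc t ∸ k)) % suc t) eq) (unshift n≤t))
  where
  unshift : ∀ {x} → x ≤ t → ((x + k) % suc t + (suc t ∸ k)) % suc t ≡ x
  unshift {x} x≤t = begin
    ((x + k) % suc t + (suc t ∸ k)) % suc t  ≡⟨ [m%n+o]%n≡[m+o]%n (x + k) (suc t ∸ k) (suc t) ⟩
    (x + k + (suc t ∸ k)) % suc t            ≡⟨ cong (_% suc t) (+-assoc x k (suc t ∸ k)) ⟩
    (x + (k + (suc t ∸ k))) % suc t          ≡⟨ cong (λ y → (x + y) % suc t) (m+[n∸m]≡n k≤1+t) ⟩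
    (x + suc t) % suc t                      ≡⟨ [m+n]%n≡m%n x (suc t) ⟩
    x % suc t                                ≡⟨ m≤n⇒m%n≡m x≤t ⟩
    x                                        ∎
    where open ≡-Reasoning

-- Relabelings preserving the ρ̄ conditions

module _ {s t : ℕ} {E : List (Edge s)} {f g : Vertex s → ℕ} where

  IsRhoBar-sameLabels : IsRhoBar s E t f →
    (∀ v → g v ≤ t) → (∀ u v → g u ≡ g v → u ≡ v) →
    (∀ e → edgeLabel g e ≡ edgeLabel f e) → IsRhoBar s E t g
  IsRhoBar-sameLabels (_ , _ , 2m≤t , f̃-inj , f̃-free) g≤t g-inj same =
    g≤t , g-inj , 2m≤t , g̃-inj , λ i 1≤i i≤m (gi , gi′) → f̃-free i 1≤i i≤m (transport gi , transport gi′)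
    where
    g̃-inj : ∀ e e′ → e ∈ E → e′ ∈ E → edgeLabel g e ≡ edgeLabel g e′ → e ≡ e′
    g̃-inj e e′ e∈E e′∈E eq = f̃-inj e e′ e∈E e′∈E (trans (sym (same e)) (trans eq (same e′)))
    transport : ∀ {d} → InEdgeImage E g d → InEdgeImage E f d
    transport (e , e∈E , eq) = e , e∈E , trans (sym (same e)) eq

  IsRhoBar-complementLabels : IsRhoBar s E t f →
    (∀ v → g v ≤ t) → (∀ u v → g u ≡ g v → u ≡ v) →
    (∀ e → edgeLabel g e ≡ suc t ∸ edgeLabel f e) → IsRhoBar s E t g
  IsRhoBar-complementLabels (f≤t , _ , 2m≤t , f̃-inj , f̃-free) g≤t g-inj compl =
    g≤t , g-inj , 2m≤t , g̃-inj , g̃-free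
    where
    f̃≡ : ∀ {e d} → edgeLabel g e ≡ d → edgeLabel f e ≡ suc t ∸ d
    f̃≡ {e@(a , b)} eq = trans (sym (m∸[m∸n]≡n f̃e≤1+t)) (cong (suc t ∸_) (trans (sym (compl e)) eq))
      where
      f̃e≤1+t : edgeLabel f e ≤ suc t
      f̃e≤1+t = m≤n⇒m≤1+n (≤-trans (∣m-n∣≤m⊔n (f (inj₁ a)) (f (inj₂ b))) (⊔-lub (f≤t _) (f≤t _)))
    g̃-inj : ∀ e e′ → e ∈ E → e′ ∈ E → edgeLabel g e ≡ edgeLabel g e′ → e ≡ e′
    g̃-inj e e′ e∈E e′∈E eq = f̃-inj e e′ e∈E e′∈E (trans (f̃≡ eq) (sym (f̃≡ refl)))
    g̃-free : ∀ i → 1 ≤ i → i ≤ length E → ¬ (InEdgeImage E g i × InEdgeImage E g (suc t ∸ i))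
    g̃-free i 1≤i i≤m ((e , e∈E , gi) , (e′ , e′∈E , gi′)) =
      f̃-free i 1≤i i≤m ((e′ , e′∈E , trans (f̃≡ gi′) (m∸[m∸n]≡n i≤1+t)) , (e , e∈E , f̃≡ gi))
      where
      i≤1+t : i ≤ suc t
      i≤1+t = m≤n⇒m≤1+n (≤-trans i≤m (≤-trans (m≤m+n (length E) _) 2m≤t))

-- Shifting a labeling that puts A below B

IsUOAB⇒A<B : ∀ {E : List (Edge s)} {g} → IsUOAB s E t g → ∀ a b → g (inj₁ a) < g (inj₂ b)
IsUOAB⇒A<B (_ , _ , A≤λ , λ<B) a b = ≤-<-trans (A≤λ a) (λ<B b)

IsUOBA⇒B<A : ∀ {E : List (Edge s)} {g} → IsUOBA s E t g → ∀ a b → g (inj₂ b) < g (inj₁ a)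
IsUOBA⇒B<A (_ , _ , B≤λ , λ<A) a b = ≤-<-trans (B≤λ b) (λ<A a)

record Stacked (s t : ℕ) (f : Vertex s → ℕ) : Set where
  field
    argminA argmaxA argminB argmaxB : Fin s
    A-between : ∀ a → f (inj₁ argminA) ≤ f (inj₁ a) × f (inj₁ a) ≤ f (inj₁ argmaxA)
    B-above   : ∀ b → f (inj₂ argminB) ≤ f (inj₂ b)
    maxA<minB : f (inj₁ argmaxA) < f (inj₂ argminB)
    maxB≡t    : f (inj₂ argmaxB) ≡ t

  minA maxA minB : ℕ
  minA = f (inj₁ argminA)
  maxA = f (inj₁ argmaxA)
  minB = f (inj₂ argminB)

module StackedShift {s t : ℕ} {E : List (Edge s)} {f : Vertex s → ℕ}
                    (ρ : IsRhoBar s E t f) (S : Stacked s t f) where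
  open Stacked S

  private
    f≤t : ∀ v → f v ≤ t
    f≤t = proj₁ ρ

    minA≤ : ∀ v → minA ≤ f v
    minA≤ (inj₁ a) = proj₁ (A-between a)
    minA≤ (inj₂ b) = ≤-trans (proj₂ (A-between argminA)) (≤-trans (<⇒≤ maxA<minB) (B-above b))

    maxA<B : ∀ b → maxA < f (inj₂ b)
    maxA<B b = <-≤-trans maxA<minB (B-above b)

  shift-≤ : ∀ k v → shift t f k v ≤ t
  shift-≤ k v = s≤s⁻¹ (m%n<n (f v + k) (suc t))

  shift-injective : k ≤ t → ∀ u v → shift t f k u ≡ shift t f k v → u ≡ v
  shift-injective k≤t u v eq =
    proj₁ (proj₂ ρ) u v ([m+k]%[1+t]≡[n+k]%[1+t]⇒m≡n (f≤t u) (f≤t v) (m≤n⇒m≤1+n k≤t) eq)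

  shift-noWrap : ∀ {k v} → f v + k ≤ t → shift t f k v ≡ f v + k
  shift-noWrap = m≤n⇒m%n≡m

  shift-wrap : ∀ {k v} → k ≤ t → t < f v + k → shift t f k v + suc t ≡ f v + k
  shift-wrap k≤t = [m+n]%[1+t]+[1+t]≡m+n (f≤t _) k≤t

  shift-maxB : k ≤ t → shift t f (suc k) (inj₂ argmaxB) ≡ k
  shift-maxB {k} k≤t = trans (cong (λ x → (x + suc k) % suc t) maxB≡t) ([t+1+k]%[1+t]≡k k≤t)

  -- c = 0 when no label wraps, c = t + 1 when every label wraps.
  OffsetBy : ℕ → ℕ → Set
  OffsetBy c k = ∀ v → shift t f k v + c ≡ f v + k

  module _ {c k : ℕ} (off : OffsetBy c k) where

    offset-isRhoBar : k ≤ t → IsRhoBar s E t (shift t f k)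
    offset-isRhoBar k≤t = IsRhoBar-sameLabels ρ (shift-≤ k) (shift-injective k≤t)
      λ (a , b) → ∣-∣-offset {shift t f k (inj₁ a)} {shift t f k (inj₂ b)} {f (inj₁ a)} {f (inj₂ b)}
                              (off (inj₁ a)) (off (inj₂ b))

    offset-mono-≤ : ∀ {u v} → f u ≤ f v → shift t f k u ≤ shift t f k v
    offset-mono-≤ {u} {v} le = +-cancelʳ-≤ c _ _ (subst₂ _≤_ (sym (off u)) (sym (off v)) (+-monoˡ-≤ k le))

    offset-mono-< : ∀ {u v} → f u < f v → shift t f k u < shift t f k v
    offset-mono-< {u} {v} lt = +-cancelʳ-< c _ _ (subst₂ _<_ (sym (off u)) (sym (off v)) (+-monoˡ-< k lt))

  isUOAB-shift⇒ : ∀ {k} → k ≤ t → IsUOAB s E t (shift t f k) → k ≡ 0 ⊎ t < minA + k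
  isUOAB-shift⇒ {zero}  _   _  = inj₁ refl
  isUOAB-shift⇒ {suc k} k<t uo with minA + suc k ≤? t
  ... | no  ¬fits = inj₂ (≰⇒> ¬fits)
  ... | yes fits  = contradiction (m≤n+m (suc k) minA) (<-asym A<B)
    where
    A<B : minA + suc k < k
    A<B = subst₂ _<_ (shift-noWrap fits) (shift-maxB (<⇒≤ k<t)) (IsUOAB⇒A<B uo argminA argmaxB)

  isUOAB-condition⇒offset : k ≤ t → k ≡ 0 ⊎ t < minA + k → ∃[ c ] OffsetBy c k
  isUOAB-condition⇒offset k≤t (inj₁ refl) =
    0 , λ v → trans (+-identityʳ _) (shift-noWrap (subst (_≤ t) (sym (+-identityʳ (f v))) (f≤t v)))
  isUOAB-condition⇒offset {k} k≤t (inj₂ t<minA+k) =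
    suc t , λ v → shift-wrap k≤t (<-≤-trans t<minA+k (+-monoˡ-≤ k (minA≤ v)))

  isUOAB-shift⇐ : k ≤ t → k ≡ 0 ⊎ t < minA + k → IsUOAB s E t (shift t f k)
  isUOAB-shift⇐ {k} k≤t cond with isUOAB-condition⇒offset k≤t cond
  ... | c , off = offset-isRhoBar off k≤t , shift t f k (inj₁ argmaxA) ,
                  (λ a → offset-mono-≤ off (proj₂ (A-between a))) , (λ b → offset-mono-< off (maxA<B b))

  isUOAB-shift⇔ : k ≤ t → IsUOAB s E t (shift t f k) ⇔ (k ≡ 0 ⊎ t < minA + k)
  isUOAB-shift⇔ k≤t = mk⇔ (isUOAB-shift⇒ k≤t) (isUOAB-shift⇐ k≤t)

  isUOBA-shift⇒maxA-fits : ∀ {k} → k ≤ t → IsUOBA s E t (shift t f k) → maxA + k ≤ t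
  isUOBA-shift⇒maxA-fits {zero}  _   _  = subst (_≤ t) (sym (+-identityʳ maxA)) (f≤t _)
  isUOBA-shift⇒maxA-fits {suc k} k<t uo with maxA + suc k ≤? t
  ... | yes fits  = fits
  ... | no  ¬fits = contradiction (f≤t (inj₁ argmaxA)) (<⇒≱ (+-cancelʳ-≤ (suc k) (suc t) maxA wrapped))
    where
    B<A : k < shift t f (suc k) (inj₁ argmaxA)
    B<A = subst (_< shift t f (suc k) (inj₁ argmaxA)) (shift-maxB (<⇒≤ k<t)) (IsUOBA⇒B<A uo argmaxA argmaxB)
    wrapped : suc t + suc k ≤ maxA + suc k
    wrapped = subst₂ _≤_ (+-comm (suc k) (suc t)) (shift-wrap k<t (≰⇒> ¬fits)) (+-monoˡ-≤ (suc t) B<A)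

  isUOBA-shift⇒minB-wraps : k ≤ t → IsUOBA s E t (shift t f k) → t < minB + k
  isUOBA-shift⇒minB-wraps {k} k≤t uo with minB + k ≤? t
  ... | no  ¬fits = ≰⇒> ¬fits
  ... | yes fits  = contradiction maxA<minB (<-asym (+-cancelʳ-< k minB maxA B<A))
    where
    B<A : minB + k < maxA + k
    B<A = subst₂ _<_ (shift-noWrap fits) (shift-noWrap (isUOBA-shift⇒maxA-fits k≤t uo))
                     (IsUOBA⇒B<A uo argmaxA argminB)

  isUOBA-shift⇐ : t < minB + k → maxA + k ≤ t → IsUOBA s E t (shift t f k)
  isUOBA-shift⇐ {zero} t<minB _ = contradiction (subst (t <_) (+-identityʳ minB) t<minB) (≤⇒≯ (f≤t _))
  isUOBA-shift⇐ {suc k} t<minB+k maxA+k≤t =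
    IsRhoBar-complementLabels ρ (shift-≤ (suc k)) (shift-injective k<t) complement , k , B≤k , k<A
    where
    k<t : suc k ≤ t
    k<t = m+n≤o⇒n≤o maxA maxA+k≤t
    A-rigid : ∀ a → shift t f (suc k) (inj₁ a) ≡ f (inj₁ a) + suc k
    A-rigid a = shift-noWrap (≤-trans (+-monoˡ-≤ (suc k) (proj₂ (A-between a))) maxA+k≤t)
    B-wraps : ∀ b → shift t f (suc k) (inj₂ b) + suc t ≡ f (inj₂ b) + suc k
    B-wraps b = shift-wrap k<t (<-≤-trans t<minB+k (+-monoˡ-≤ (suc k) (B-above b)))
    complement : ∀ e → edgeLabel (shift t f (suc k)) e ≡ suc t ∸ edgeLabel f e
    complement (a , b) = begin
      ∣ shift t f (suc k) (inj₁ a) - shift t f (suc k) (inj₂ b) ∣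
        ≡⟨ m+n≡o+p⇒n≤p⇒∣m-o∣≡p∸n gap (≤-trans (m∸n≤m (f (inj₂ b)) (f (inj₁ a))) (m≤n⇒m≤1+n (f≤t _))) ⟩
      suc t ∸ (f (inj₂ b) ∸ f (inj₁ a))
        ≡⟨ cong (suc t ∸_) (m≤n⇒∣m-n∣≡n∸m fa≤fb) ⟨
      suc t ∸ ∣ f (inj₁ a) - f (inj₂ b) ∣ ∎
      where
      open ≡-Reasoning
      fa≤fb : f (inj₁ a) ≤ f (inj₂ b)
      fa≤fb = ≤-trans (proj₂ (A-between a)) (<⇒≤ (maxA<B b))
      gap : shift t f (suc k) (inj₁ a) + (f (inj₂ b) ∸ f (inj₁ a)) ≡ shift t f (suc k) (inj₂ b) + suc t
      gap = begin
        shift t f (suc k) (inj₁ a) + (f (inj₂ b) ∸ f (inj₁ a))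
          ≡⟨ cong (_+ (f (inj₂ b) ∸ f (inj₁ a))) (A-rigid a) ⟩
        f (inj₁ a) + suc k + (f (inj₂ b) ∸ f (inj₁ a))
          ≡⟨ +-comm (f (inj₁ a) + suc k) _ ⟩
        (f (inj₂ b) ∸ f (inj₁ a)) + (f (inj₁ a) + suc k)
          ≡⟨ +-assoc _ (f (inj₁ a)) (suc k) ⟨
        (f (inj₂ b) ∸ f (inj₁ a)) + f (inj₁ a) + suc k
          ≡⟨ cong (_+ suc k) (m∸n+n≡m fa≤fb) ⟩
        f (inj₂ b) + suc k
          ≡⟨ B-wraps b ⟨
        shift t f (suc k) (inj₂ b) + suc t ∎
    B≤k : ∀ b → shift t f (suc k) (inj₂ b) ≤ k
    B≤k b = +-cancelʳ-≤ (suc t) (shift t f (suc k) (inj₂ b)) k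
      (subst₂ _≤_ (sym (B-wraps b)) (+-suc-comm t k) (+-monoˡ-≤ (suc k) (f≤t _)))
    k<A : ∀ a → k < shift t f (suc k) (inj₁ a)
    k<A a = subst (k <_) (sym (A-rigid a)) (m≤n+m (suc k) (f (inj₁ a)))

  isUOBA-shift⇔ : k ≤ t → IsUOBA s E t (shift t f k) ⇔ (t < minB + k × maxA + k ≤ t)
  isUOBA-shift⇔ k≤t = mk⇔ (λ uo → isUOBA-shift⇒minB-wraps k≤t uo , isUOBA-shift⇒maxA-fits k≤t uo)
                          (λ (wraps , fits) → isUOBA-shift⇐ wraps fits)

-- The sequences x and y

module _ (a : ℕ → ℕ) where

  private
    odd-sum even-sum : ℕ → ℤ
    odd-sum i  = sumTo i (λ j → + a (suc (2 * j)))
    even-sum i = sumTo i (λ j → + a (2 * suc j))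

  xs-one : xs a 1 ≡ + a 1
  xs-one = cong +_ (+-identityʳ (a 1))

  xs+r≡ys+a : ∀ r i → xs a (suc i) +ℤ + r ≡ ys a r i +ℤ + a (suc (2 * i))
  xs+r≡ys+a r i = identity (odd-sum i) (even-sum i) (+ a (suc (2 * i))) (+ r)
    where
    identity : ∀ o e c r → ((o +ℤ c) -ℤ e) +ℤ r ≡ ((o -ℤ e) +ℤ r) +ℤ c
    identity = solve-∀

  xs-step : ∀ i → xs a (suc (suc i)) +ℤ + a (2 * suc i) ≡ xs a (suc i) +ℤ + a (suc (2 * suc i))
  xs-step i =
    identity (odd-sum i) (even-sum i) (+ a (suc (2 * i))) (+ a (suc (2 * suc i))) (+ a (2 * suc i))
    where
    identity : ∀ o e c c′ d → (((o +ℤ c) +ℤ c′) -ℤ (e +ℤ d)) +ℤ d ≡ ((o +ℤ c) -ℤ e) +ℤ c′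
    identity = solve-∀

  ys-step : ∀ r i → ys a r (suc i) +ℤ + a (2 * suc i) ≡ ys a r i +ℤ + a (suc (2 * i))
  ys-step r i = identity (odd-sum i) (even-sum i) (+ a (suc (2 * i))) (+ a (2 * suc i)) (+ r)
    where
    identity : ∀ o e c d r → (((o +ℤ c) -ℤ (e +ℤ d)) +ℤ r) +ℤ d ≡ ((o -ℤ e) +ℤ r) +ℤ c
    identity = solve-∀

module _ {n : ℕ} {a : ℕ → ℕ} (a-inc : ∀ i → 1 ≤ i → i ≤ 2 * suc n ∸ 2 → a i < a (suc i)) where

  private
    a-inc′ : ∀ i → 1 ≤ i → i ≤ 2 * n → a i ≤ a (suc i)
    a-inc′ i 1≤i i≤2n = <⇒≤ (a-inc i 1≤i (subst (i ≤_) (sym (cong (_∸ 2) (*-suc 2 n))) i≤2n))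

  xs-monotone : ∀ {i j} → 1 ≤ i → i ≤ j → j ≤ suc n → xs a i ≤ℤ xs a j
  xs-monotone = stepwise⇒monotone {_≼_ = _≤ℤ_} ℤ.≤-refl ℤ.≤-trans (xs a) step
    where
    step : ∀ m → 1 ≤ m → suc m ≤ suc n → xs a m ≤ℤ xs a (suc m)
    step (suc i) _ (s≤s i<n) =
      p+c≡q+d⇒c≤d⇒q≤p (xs-step a i) (+≤+ (a-inc′ (2 * suc i) (s≤s z≤n) (*-monoʳ-≤ 2 i<n)))

  ys-antitone : ∀ r {i j} → i ≤ j → j ≤ n → ys a r j ≤ℤ ys a r i
  ys-antitone r = stepwise⇒monotone {_≼_ = flip _≤ℤ_} ℤ.≤-refl (flip ℤ.≤-trans) (ys a r) step z≤n
    where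
    step : ∀ m → 0 ≤ m → suc m ≤ n → ys a r (suc m) ≤ℤ ys a r m
    step m _ m<n = p+c≡q+d⇒c≤d⇒q≤p (sym (ys-step a r m))
      (+≤+ (subst (a (suc (2 * m)) ≤_) (cong a (sym (*-suc 2 m))) (a-inc′ (suc (2 * m)) (s≤s z≤n) 2m+1≤2n)))
      where
      2m+1≤2n : suc (2 * m) ≤ 2 * n
      2m+1≤2n = ≤-trans (n≤1+n _) (subst (_≤ 2 * n) (*-suc 2 m) (*-monoʳ-≤ 2 m<n))

XImage : (ℕ → ℕ) → ℕ → ℤ → Set
XImage a s z = ∃[ i ] (1 ≤ i × i ≤ s × z ≡ xs a i -ℤ + 1)

YImage : (ℕ → ℕ) → ℕ → ℕ → ℤ → Set
YImage a r s z = (∃[ i ] (1 ≤ i × i ≤ s ∸ 1 × z ≡ ys a r i -ℤ + 1)) ⊎ (z ≡ + r -ℤ + 1)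

-- y₀ = r, so the extra label r - 1 of B is the i = 0 instance of yᵢ - 1.
YImage⇒index : ∀ {a r s z} → YImage a r s z → ∃[ i ] (i ≤ s ∸ 1 × z ≡ ys a r i -ℤ + 1)
YImage⇒index (inj₁ (i , _ , i≤s-1 , eq)) = i , i≤s-1 , eq
YImage⇒index (inj₂ eq)                   = 0 , z≤n , eq

index⇒YImage : ∀ {a r s i} → i ≤ s ∸ 1 → YImage a r s (ys a r i -ℤ + 1)
index⇒YImage {i = zero}  _       = inj₂ refl
index⇒YImage {i = suc i} i≤s-1 = inj₁ (suc i , s≤s z≤n , i≤s-1 , refl)

module CorollaryLabeling {n t : ℕ} {a : ℕ → ℕ} {f : Vertex (suc n) → ℕ}
         (a-inc : ∀ i → 1 ≤ i → i ≤ 2 * suc n ∸ 2 → a i < a (suc i)) (aₗ≤t : a (suc (2 * n)) ≤ t)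
         (f≤t : ∀ v → f v ≤ t)
         (imA : ImageIs (λ u → f (inj₁ u)) (XImage a (suc n)))
         (imB : ImageIs (λ u → f (inj₂ u)) (YImage a (suc t) (suc n))) where

  private
    x-label : ∀ u → ∃[ i ] (1 ≤ i × i ≤ suc n × xs a i ≡ + suc (f (inj₁ u)))
    x-label u with proj₁ imA u
    ... | i , 1≤i , i≤s , eq = i , 1≤i , i≤s , +m≡p-1⇒p≡+[1+m] eq

    y-label : ∀ b → ∃[ i ] (i ≤ n × ys a (suc t) i ≡ + suc (f (inj₂ b)))
    y-label b with YImage⇒index {a} {suc t} {suc n} (proj₁ imB b)
    ... | i , i≤n , eq = i , i≤n , +m≡p-1⇒p≡+[1+m] eq

    x-attained : ∀ i → 1 ≤ i → i ≤ suc n → ∃[ u ] xs a i ≡ + suc (f (inj₁ u))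
    x-attained i 1≤i i≤s with proj₂ imA _ (i , 1≤i , i≤s , refl)
    ... | u , eq = u , +m≡p-1⇒p≡+[1+m] eq

    y-attained : ∀ i → i ≤ n → ∃[ b ] ys a (suc t) i ≡ + suc (f (inj₂ b))
    y-attained i i≤n with proj₂ imB _ (index⇒YImage {a} {suc t} {suc n} i≤n)
    ... | b , eq = b , +m≡p-1⇒p≡+[1+m] eq

    t-attained : ∃[ b ] f (inj₂ b) ≡ t
    t-attained with proj₂ imB _ (inj₂ refl)
    ... | b , eq = b , ℤ.+-injective eq

    minA-attained : ∃[ u ] xs a 1 ≡ + suc (f (inj₁ u))
    minA-attained = x-attained 1 ≤-refl (s≤s z≤n)

    maxA-attained : ∃[ u ] xs a (suc n) ≡ + suc (f (inj₁ u))
    maxA-attained = x-attained (suc n) (s≤s z≤n) ≤-refl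

    minB-attained : ∃[ b ] ys a (suc t) n ≡ + suc (f (inj₂ b))
    minB-attained = y-attained n ≤-refl

    A-between : ∀ u → f (inj₁ (proj₁ minA-attained)) ≤ f (inj₁ u)
                    × f (inj₁ u) ≤ f (inj₁ (proj₁ maxA-attained))
    A-between u with x-label u
    ... | i , 1≤i , i≤s , eq =
      +[1+m]≤+[1+n]⇒m≤n (proj₂ minA-attained) eq (xs-monotone a-inc ≤-refl 1≤i i≤s) ,
      +[1+m]≤+[1+n]⇒m≤n eq (proj₂ maxA-attained) (xs-monotone a-inc 1≤i i≤s ≤-refl)

    B-above : ∀ b → f (inj₂ (proj₁ minB-attained)) ≤ f (inj₂ b)
    B-above b with y-label b
    ... | i , i≤n , eq = +[1+m]≤+[1+n]⇒m≤n (proj₂ minB-attained) eq (ys-antitone a-inc (suc t) i≤n ≤-refl)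

    maxA<minB : f (inj₁ (proj₁ maxA-attained)) < f (inj₂ (proj₁ minB-attained))
    maxA<minB = +-cancelʳ-≤ (suc t) _ _ (begin
      suc maxA + suc t         ≡⟨ ℤ.+-injective (subst₂ (λ x y → x +ℤ + suc t ≡ y +ℤ + a (suc (2 * n)))
                                    (proj₂ maxA-attained) (proj₂ minB-attained) (xs+r≡ys+a a (suc t) n)) ⟩
      suc minB + a (suc (2 * n)) ≤⟨ +-monoʳ-≤ (suc minB) aₗ≤t ⟩
      suc minB + t             ≡⟨ +-suc minB t ⟨
      minB + suc t             ∎)
      where
      open ≤-Reasoning
      maxA minB : ℕ
      maxA = f (inj₁ (proj₁ maxA-attained))
      minB = f (inj₂ (proj₁ minB-attained))

  corollary-stacked : Stacked (suc n) t f
  corollary-stacked = record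
    { argminA = proj₁ minA-attained ; argmaxA = proj₁ maxA-attained
    ; argminB = proj₁ minB-attained ; argmaxB = proj₁ t-attained
    ; A-between = A-between ; B-above = B-above ; maxA<minB = maxA<minB ; maxB≡t = proj₂ t-attained }

  open Stacked corollary-stacked

  a₁≡1+minA : a 1 ≡ suc minA
  a₁≡1+minA = ℤ.+-injective (trans (sym (xs-one a)) (proj₂ minA-attained))

  xₛ≡1+maxA : xs a (suc n) ≡ + suc maxA
  xₛ≡1+maxA = proj₂ maxA-attained

  yₛ₋₁≡1+minB : ys a (suc t) n ≡ + suc minB
  yₛ₋₁≡1+minB = proj₂ minB-attained

isUOAB-condition⇔ : ∀ {a₁ m} → a₁ ≡ suc m → k ≤ t →
  (k ≡ 0 ⊎ t < m + k) ⇔ (k ≡ 0 ⊎ (suc t + 1 ∸ a₁ ≤ k × k ≤ t))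
isUOAB-condition⇔ refl k≤t = ⇔.refl ⊎-⇔ ⇔.trans (⇔.sym m+1∸n≤k⇔m<n+k) (mk⇔ (_, k≤t) proj₁)

isUOAB-condition⇔k≡0 : ∀ {a₁ m} → a₁ ≡ suc m → a₁ ≡ 1 → k ≤ t → (k ≡ 0 ⊎ t < m + k) ⇔ (k ≡ 0)
isUOAB-condition⇔k≡0 refl refl k≤t = mk⇔ [ id , (λ t<k → contradiction k≤t (<⇒≱ t<k)) ] inj₁

isUOBA-condition⇔ : ∀ {x y maxA minB} → x ≡ + suc maxA → y ≡ + suc minB → maxA ≤ t → minB ≤ t →
  (t < minB + k × maxA + k ≤ t) ⇔ (+ (suc t + 1) -ℤ y ≤ℤ + k × + k ≤ℤ + suc t -ℤ x)
isUOBA-condition⇔ {t} {k} {maxA = maxA} {minB} refl refl maxA≤t minB≤t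
  rewrite +[1+m]-+[1+n]≡+[m∸n] (t + 1) minB (≤-trans minB≤t (m≤m+n t 1))
        | +[1+m]-+[1+n]≡+[m∸n] t maxA maxA≤t =
  ⇔.trans (⇔.sym m+1∸n≤k⇔m<n+k) (⇔.sym +≤+⇔≤) ×-⇔ ⇔.trans (⇔.sym (k≤m∸n⇔n+k≤m maxA≤t)) (⇔.sym +≤+⇔≤)

corollary3 : (r s : ℕ) (a : ℕ → ℕ) → 1 ≤ s → 2 * s ≤ r →
    (∀ i → 1 ≤ i → i ≤ 2 * s ∸ 1 → 1 ≤ a i × a i ≤ r ∸ 1) →
    (∀ i → 1 ≤ i → i ≤ 2 * s ∸ 2 → a i < a (suc i)) →
    (E : List (Edge s)) → IsBipGraph s E →
    (f : Vertex s → ℕ) → IsRhoBar s E (r ∸ 1) f →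
    ImageIs (λ u → f (inj₁ u))
      (λ z → ∃[ i ] (1 ≤ i × i ≤ s × z ≡ xs a i -ℤ ℤ+ 1)) →
    ImageIs (λ u → f (inj₂ u))
      (λ z → (∃[ i ] (1 ≤ i × i ≤ s ∸ 1 × z ≡ ys a r i -ℤ ℤ+ 1)) ⊎ (z ≡ ℤ+ r -ℤ ℤ+ 1)) →
    (∀ k → k ≤ r ∸ 1 →
      (2 ≤ a 1 → (IsUOAB s E (r ∸ 1) (shift (r ∸ 1) f k)
                    ⇔ (k ≡ 0 ⊎ (r + 1 ∸ a 1 ≤ k × k ≤ r ∸ 1))))
      × (a 1 ≡ 1 → (IsUOAB s E (r ∸ 1) (shift (r ∸ 1) f k) ⇔ k ≡ 0)))
    × (∀ k → k ≤ r ∸ 1 →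
      (IsUOBA s E (r ∸ 1) (shift (r ∸ 1) f k)
        ⇔ (ℤ+ (r + 1) -ℤ ys a r (s ∸ 1) ≤ℤ ℤ+ k × ℤ+ k ≤ℤ ℤ+ r -ℤ xs a s)))
corollary3 zero    (suc _) _ _ ()
corollary3 (suc t) (suc n) a (s≤s _) _ a-range a-inc E _ f ρ imA imB =
  (λ k k≤t → (λ _ → ⇔.trans (isUOAB-shift⇔ k≤t) (isUOAB-condition⇔ a₁≡1+minA k≤t)) ,
             (λ a₁≡1 → ⇔.trans (isUOAB-shift⇔ k≤t) (isUOAB-condition⇔k≡0 a₁≡1+minA a₁≡1 k≤t))) ,
  (λ k k≤t → ⇔.trans (isUOBA-shift⇔ k≤t) (isUOBA-condition⇔ xₛ≡1+maxA yₛ₋₁≡1+minB (f≤t _) (f≤t _)))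
  where
  f≤t : ∀ v → f v ≤ t
  f≤t = proj₁ ρ
  aₗ≤t : a (suc (2 * n)) ≤ t
  aₗ≤t = proj₂ (a-range (suc (2 * n)) (s≤s z≤n) (≤-reflexive (sym (cong (_∸ 1) (*-suc 2 n)))))
  open CorollaryLabeling a-inc aₗ≤t f≤t imA imB
  open StackedShift ρ corollary-stacked
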